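{- Let $G_r=(V_r,E_r)$ (virtual network) and $G_s=(V_s,E_s)$ (substrate network) be simple, connected, undirected graphs, with integer demands $d$ on $V_r\cup E_r$ and integer capacities $c$ on $V_s\cup E_s$. Let $m=(m_V,m_E)$ be any feasible mapping of $G_r$ on $G_s$ and let $(x,y)=\chi(m)$ be its incidence vector. Then for every virtual edge $\bar e=(\bar u,\bar v)\in E_r$ and every substrate node $u\in V_s$, the flow-departure inequality $$x_{\bar u u}\le \sum_{e\in\delta^+(u)} y_{\bar e e}$$ holds. Consequently this inequality is valid for the VNE polytope $\mathrm{conv}\{\chi(m): m \text{ feasible mapping}\}$.
   Context: A mapping $m=(m_V,m_E)$ of $G_r$ on $G_s$ consists of an injective (one-to-one) node placement $m_V:V_r\to V_s$ and an edge routing $m_E$ assigning to each $\bar e=(\bar u,\bar v)\in E_r$ a loop-free path $m_E(\bar e)$ of $G_s$ with endpoints $m_V(\bar u)$ and $m_V(\bar v)$. It is feasible if for each $u\in V_s$ the sum of $d_{\bar u}$ over virtual nodes placed on $u$ is at most $c_u$, and for each $e\in E_s$ the sum of $d_{\bar e}$ over virtual edges whose path uses $e$ is at most $c_e$. Each virtual edge is given a fixed orientation $\bar e=(\bar u,\bar v)$. Let $E'_s=\bigcup_{\{u,v\}\in E_s}\{(u,v),(v,u)\}$ be the arc set of the bidirected substrate network, and for $u\in V_s$ let $\delta^+(u)$ (resp. $\delta^-(u)$) denote the arcs of $E'_s$ leaving (resp. entering) $u$. The incidence vector $\chi(m)=(x,y)$ has components $x_{\bar u u}\in\{0,1\}$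 for $\bar u\in V_r,u\in V_s$, with $x_{\bar u u}=1$ iff $m_V(\bar u)=u$, and $y_{\bar e a}\in\{0,1\}$ for $\bar e\in E_r$, $a\in E'_s$, with $y_{\bar e (u,v)}=1$ iff the path $m_E(\bar e)$, traversed from $m_V(\bar u)$ to $m_V(\bar v)$, uses the substrate edge $\{u,v\}$ in the direction from $u$ to $v$. -}

module Defs where

open import Data.Nat as ℕ using (ℕ; zero; suc)
open import Data.Integer as ℤ using (ℤ)
open import Data.Fin as Fin using (Fin)
open import Data.Bool using (Bool; true; false; if_then_else_)
open import Data.Product using (_×_; _,_; proj₁; proj₂; swap)
open import Data.Product.Properties using (≡-dec)
open import Data.Sum using (_⊎_)
open import Data.List using (List; []; _∷_; map)
open import Data.List.Relation.Unary.Any using (any?)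
open import Data.List.Relation.Unary.Unique.Propositional using (Unique)
open import Relation.Binary.PropositionalEquality using (_≡_; _≢_)
open import Relation.Nullary using (does)
open import Function.Definitions using (Injective)
import Data.Bool.Properties as BoolP
import Data.List.Membership.DecPropositional as DecMem

-- Finite undirected graphs: nodes Fin nV, edges Fin nE, each edge
-- {u,v} stored with a fixed orientation ends e = (u , v).

record Graph : Set where
  field
    nV nE : ℕ
    ends  : Fin nE → Fin nV × Fin nV

  Node : Set
  Node = Fin nV

  Edge : Set
  Edge = Fin nE

  src dst : Edge → Node
  src e = proj₁ (ends e)
  dst e = proj₂ (ends e)

open Graph public

record Simple (G : Graph) : Set where
  field
    loopFree   : ∀ e → src G e ≢ dst G e
    noParallel : ∀ e f → (ends G e ≡ ends G f ⊎ ends G e ≡ swap (ends G f)) → e ≡ f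

data Reach (G : Graph) : Node G → Node G → Set where
  here  : ∀ {u} → Reach G u u
  fwd   : ∀ {w} e → Reach G (dst G e) w → Reach G (src G e) w
  bwd   : ∀ {w} e → Reach G (src G e) w → Reach G (dst G e) w

Connected : Graph → Set
Connected G = ∀ u v → Reach G u v

-- Arcs of the bidirected graph E'_s: (e , false) = (src e , dst e),
-- (e , true) = (dst e , src e).

Arc : Graph → Set
Arc G = Edge G × Bool

tail head : (G : Graph) → Arc G → Node G
tail G (e , false) = src G e
tail G (e , true)  = dst G e
head G (e , false) = dst G e
head G (e , true)  = src G e

arc-≟ : (G : Graph) → (a b : Arc G) → _
arc-≟ G = ≡-dec Fin._≟_ BoolP._≟_

data Walk (G : Graph) : Node G → Node G → List (Arc G) → Set where
  nil  : ∀ {s} → Walk G s s []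
  cons : ∀ {t as} a → Walk G (head G a) t as → Walk G (tail G a) t (a ∷ as)

visits : (G : Graph) → Node G → List (Arc G) → List (Node G)
visits G s as = s ∷ map (head G) as

IsPath : (G : Graph) → Node G → Node G → List (Arc G) → Set
IsPath G s t as = Walk G s t as × Unique (visits G s as)

record Mapping (Gr Gs : Graph) : Set where
  field
    mV : Node Gr → Node Gs
    mE : Edge Gr → List (Arc Gs)

open Mapping public

IsMapping : (Gr Gs : Graph) → Mapping Gr Gs → Set
IsMapping Gr Gs m =
  Injective _≡_ _≡_ (mV m) ×
  (∀ ē → IsPath Gs (mV m (src Gr ē)) (mV m (dst Gr ē)) (mE m ē))

Σℕ : (n : ℕ) → (Fin n → ℕ) → ℕ
Σℕ zero    f = 0
Σℕ (suc n) f = f Fin.zero ℕ.+ Σℕ n (λ i → f (Fin.suc i))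

Σℤ : (n : ℕ) → (Fin n → ℤ) → ℤ
Σℤ zero    f = ℤ.0ℤ
Σℤ (suc n) f = f Fin.zero ℤ.+ Σℤ n (λ i → f (Fin.suc i))

uses : (G : Graph) → List (Arc G) → Edge G → Bool
uses G as e = does (any? (λ a → proj₁ a Fin.≟ e) as)

Feasible : (Gr Gs : Graph) →
           (dV : Node Gr → ℤ) (dE : Edge Gr → ℤ) →
           (cV : Node Gs → ℤ) (cE : Edge Gs → ℤ) →
           Mapping Gr Gs → Set
Feasible Gr Gs dV dE cV cE m =
  (∀ u → Σℤ (nV Gr) (λ ū → if does (mV m ū Fin.≟ u) then dV ū else ℤ.0ℤ) ℤ.≤ cV u) ×
  (∀ e → Σℤ (nE Gr) (λ ē → if uses Gs (mE m ē) e then dE ē else ℤ.0ℤ) ℤ.≤ cE e)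

χx : {Gr Gs : Graph} → Mapping Gr Gs → Node Gr → Node Gs → ℕ
χx m ū u = if does (mV m ū Fin.≟ u) then 1 else 0

χy : {Gr Gs : Graph} → Mapping Gr Gs → Edge Gr → Arc Gs → ℕ
χy {Gs = Gs} m ē a =
  if does (DecMem._∈?_ (arc-≟ Gs) a (mE m ē)) then 1 else 0

Σδ⁺ : (G : Graph) → Node G → (Arc G → ℕ) → ℕ
Σδ⁺ G u f =
  Σℕ (nE G) (λ e →
    (if does (tail G (e , false) Fin.≟ u) then f (e , false) else 0) ℕ.+
    (if does (tail G (e , true)  Fin.≟ u) then f (e , true)  else 0))

{-# OPTIONS --safe #-}
-- If m_V(ū) = u, the path routing ē is not empty because its ends m_V(ū) ≠ m_V(v̄)
-- (Gr has no loops and m_V is injective); its first arc leaves u, so y contributes 1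
-- to the sum over δ⁺(u).
module Submission where

open import Defs
open import Data.Nat using (ℕ; suc; _≤_; z≤n)
open import Data.Nat.Properties using (m≤m+n; m≤n+m; ≤-trans; ≤-refl)
open import Data.Integer using (ℤ)
open import Data.Fin as Fin using (Fin)
open import Data.Bool using (false; true; if_then_else_)
open import Data.Product using (∃; _×_; _,_; proj₁)
open import Data.List.Membership.Propositional using (_∈_)
open import Data.List.Relation.Unary.Any using (here)
open import Relation.Binary.PropositionalEquality using (_≡_; _≢_; refl)
open import Relation.Nullary using (Dec; does; yes; no; contradiction)
open import Function.Definitions using (Injective)
import Data.List.Membership.DecPropositional as DecMem

x≤if-yes : ∀ {P : Set} (p? : Dec P) {x y : ℕ} → P → x ≤ (if does p? then x else y)
x≤if-yes (yes _)  _ = ≤-refl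
x≤if-yes (no ¬p) p = contradiction p ¬p

f≤Σℕ : ∀ n (f : Fin n → ℕ) i → f i ≤ Σℕ n f
f≤Σℕ (suc n) f Fin.zero    = m≤m+n _ _
f≤Σℕ (suc n) f (Fin.suc i) = ≤-trans (f≤Σℕ n (λ j → f (Fin.suc j)) i) (m≤n+m _ _)

f≤Σδ⁺ : (G : Graph) (u : Node G) (f : Arc G → ℕ) (a : Arc G) → tail G a ≡ u → f a ≤ Σδ⁺ G u f
f≤Σδ⁺ G u f (e , false) src≡u =
  ≤-trans (≤-trans (x≤if-yes (src G e Fin.≟ u) src≡u) (m≤m+n _ _)) (f≤Σℕ (nE G) _ e)
f≤Σδ⁺ G u f (e , true) dst≡u =
  ≤-trans (≤-trans (x≤if-yes (dst G e Fin.≟ u) dst≡u) (m≤n+m _ _)) (f≤Σℕ (nE G) _ e)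

walk-leaves-start : ∀ {G s t as} → Walk G s t as → s ≢ t → ∃ λ a → a ∈ as × tail G a ≡ s
walk-leaves-start nil        s≢s = contradiction refl s≢s
walk-leaves-start (cons a _) _   = a , here refl , refl

mapped-ends-distinct : ∀ {Gr Gs} (m : Mapping Gr Gs) → Simple Gr → Injective _≡_ _≡_ (mV m) →
                       ∀ ē → mV m (src Gr ē) ≢ mV m (dst Gr ē)
mapped-ends-distinct m simple inj ē eq = Simple.loopFree simple ē (inj eq)

proposition1 : (Gr Gs : Graph) →
    Simple Gr → Connected Gr → Simple Gs → Connected Gs →
    (dV : Node Gr → ℤ) (dE : Edge Gr → ℤ) →
    (cV : Node Gs → ℤ) (cE : Edge Gs → ℤ) →
    (m : Mapping Gr Gs) → IsMapping Gr Gs m → Feasible Gr Gs dV dE cV cE m →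
    ∀ ē u → χx m (src Gr ē) u ≤ Σδ⁺ Gs u (χy m ē)
proposition1 Gr Gs simpleGr _ _ _ _ _ _ _ m (inj , paths) _ ē u
  with mV m (src Gr ē) Fin.≟ u
... | no _    = z≤n
... | yes refl
  with walk-leaves-start (proj₁ (paths ē)) (mapped-ends-distinct m simpleGr inj ē)
... | a , a∈path , a-leaves-u =
  ≤-trans (x≤if-yes (DecMem._∈?_ (arc-≟ Gs) a (mE m ē)) a∈path) (f≤Σδ⁺ Gs u (χy m ē) a a-leaves-u)
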